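{- Let $\Gamma(G)$ be a connected signed graph on $n$ vertices, let $v$ be a cut-point of $\Gamma(G)$ and let $\Gamma(G_1)$ be a connected component of $\Gamma(G-v)$. If $\eta(\Gamma(G_1))=\eta(\Gamma(G_1+v))-1$, then $\eta(\Gamma(G))=\eta(\Gamma(G_1))+\eta(\Gamma(G-G_1))$.
   Context: A signed graph $\Gamma(G)=(G,\sigma)$ consists of a simple graph $G=(V,E)$ and a map $\sigma:E\to\{+,-\}$; its adjacency matrix has $(i,j)$ entry $\sigma(v_iv_j)$ if $v_iv_j\in E$ and $0$ otherwise, and its nullity $\eta(\Gamma(G))$ is the multiplicity of the eigenvalue $0$ of this matrix. Subgraphs inherit signs. A cut-point is a vertex whose removal disconnects $G$. $G-v$ denotes $G$ with $v$ and its incident edges removed; $G-G_1$ denotes $G$ with the vertices of $G_1$ (and incident edges) removed; for an induced subgraph $G_1$ and $v\notin V(G_1)$, $G_1+v$ is the subgraph induced by $V(G_1)\cup\{v\}$. -}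

module Defs where

open import Data.Nat using (ℕ; zero; suc)
open import Data.Fin using (Fin; zero; suc)
open import Data.Fin.Subset using (Subset; _∈_; _∉_; ⊤; ∁; ⁅_⁆; _∪_; Nonempty)
open import Data.Rational using (ℚ; 0ℚ; 1ℚ; -_; _+_; _*_)
open import Data.Product using (Σ; _×_; ∃; ∃-syntax)
open import Relation.Binary.PropositionalEquality using (_≡_; _≢_)
open import Relation.Nullary using (¬_)

data Sgn : Set where
  none pos neg : Sgn

record SignedGraph (n : ℕ) : Set where
  field
    edge      : Fin n → Fin n → Sgn
    symmetric : ∀ i j → edge i j ≡ edge j i
    loopless  : ∀ i → edge i i ≡ none
open SignedGraph public

Adjacent : ∀ {n} → SignedGraph n → Fin n → Fin n → Set
Adjacent G i j = edge G i j ≢ none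

sgnℚ : Sgn → ℚ
sgnℚ none = 0ℚ
sgnℚ pos  = 1ℚ
sgnℚ neg  = - 1ℚ

adj : ∀ {n} → SignedGraph n → Fin n → Fin n → ℚ
adj G i j = sgnℚ (edge G i j)

sumℚ : ∀ {n} → (Fin n → ℚ) → ℚ
sumℚ {zero}  f = 0ℚ
sumℚ {suc n} f = f zero + sumℚ (λ i → f (suc i))

data Reach {n} (G : SignedGraph n) (S : Subset n) : Fin n → Fin n → Set where
  here : ∀ {i} → i ∈ S → Reach G S i i
  step : ∀ {i k j} → i ∈ S → Adjacent G i k → Reach G S k j → Reach G S i j

ConnectedOn : ∀ {n} → SignedGraph n → Subset n → Set
ConnectedOn G S = ∀ i j → i ∈ S → j ∈ S → Reach G S i j

Connected : ∀ {n} → SignedGraph n → Set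
Connected G = ConnectedOn G ⊤

minus : ∀ {n} → Fin n → Subset n
minus v = ∁ ⁅ v ⁆

CutPoint : ∀ {n} → SignedGraph n → Fin n → Set
CutPoint G v = ¬ ConnectedOn G (minus v)

ComponentOf-v : ∀ {n} → SignedGraph n → Fin n → Subset n → Set
ComponentOf-v G v C =
  Nonempty C × (∀ i → i ∈ C → ∀ j → (j ∈ C → Reach G (minus v) i j)
                                    × (Reach G (minus v) i j → j ∈ C))

-- x (indexed by V(G), zero off S) lies in the null space of the adjacency
-- matrix of the induced subgraph G[S].
InKernel : ∀ {n} → SignedGraph n → Subset n → (Fin n → ℚ) → Set
InKernel G S x = (∀ i → i ∉ S → x i ≡ 0ℚ)
               × (∀ i → i ∈ S → sumℚ (λ j → adj G i j * x j) ≡ 0ℚ)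

LinIndep : ∀ {n k} → (Fin k → Fin n → ℚ) → Set
LinIndep {n} {k} vs = ∀ (c : Fin k → ℚ) →
  (∀ i → sumℚ (λ l → c l * vs l i) ≡ 0ℚ) → ∀ l → c l ≡ 0ℚ

Nullity : ∀ {n} → SignedGraph n → Subset n → ℕ → Set
Nullity {n} G S k =
  (∃[ vs ] ((∀ l → InKernel G S (vs l)) × LinIndep {n} {k} vs))
  × (∀ (ws : Fin (suc k) → Fin n → ℚ) → (∀ l → InKernel G S (ws l)) → ¬ LinIndep ws)

{-# OPTIONS --safe #-}
-- Pick u ∈ ker A(G₁ + v) with u_v = 1; it exists because adding v raises the nullity.
-- With u|G₁ its restriction to G₁ and φ p = p + p_v · u|G₁,
--   ker A(G) = ker A(G₁) ⊕ φ (ker A(G − G₁)),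
-- split by x ↦ (x − φ (x|G−G₁), x|G−G₁). The one non-local fact needed is that every
-- z ∈ ker A(G₁) also satisfies the row of v: by symmetry of A, (A z)_v = ⟨u, A z⟩ = ⟨z, A u⟩,
-- and this vanishes because z and A u have disjoint supports. Nullities, being the sizes
-- of maximal independent families in the kernels, then add over the splitting.
module Submission where

open import Defs
open import Data.Nat using (ℕ; zero; suc; _≤_; _<_; z≤n; s≤s)
open import Data.Nat.Properties using (_≤?_; ≤-antisym; ≮⇒≥; m≤n⇒m≤1+n; m≤n⇒m<n∨m≡n)
import Data.Nat as ℕ
open import Data.Fin using (Fin; zero; suc; punchIn; splitAt; _↑ˡ_; _↑ʳ_)
open import Data.Fin.Properties using (all?; ¬∀⟶∃¬; punchInᵢ≢i; splitAt⁻¹-↑ˡ; splitAt⁻¹-↑ʳ)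
  renaming (_≟_ to _≟ᶠ_)
open import Data.Fin.Subset using (Subset; _∈_; _∉_; ⊤; ∁; ⁅_⁆; _∪_)
open import Data.Fin.Subset.Properties
  using (_∈?_; ∈⊤; x∈⁅x⁆; x∈⁅y⁆⇒x≡y; x∈∁p⇒x∉p; x∉p⇒x∈∁p; x∈p∪q⁺; x∈p∪q⁻)
open import Data.Vec.Functional using (Vector; _∷_; _++_; tail; insertAt; removeAt)
open import Data.Vec.Functional.Properties using (lookup-++ˡ; lookup-++ʳ; insertAt-lookup; insertAt-punchIn)
open import Data.Vec.Functional.Relation.Unary.All.Properties using (++⁺)
open import Data.Bool using (if_then_else_)
open import Data.Product using (∃-syntax; _×_; _,_; proj₁; proj₂)
open import Data.Sum using (inj₁; inj₂; [_,_]′)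
open import Function using (_∘_)
open import Algebra.Bundles using (CommutativeRing)
open import Relation.Binary.PropositionalEquality
open import Relation.Nullary using (¬_; yes; no; does; contradiction)
open import Relation.Nullary.Decidable using (decidable-stable; dec-true; dec-false)

module LinearAlgebra where

  open import Data.Rational using (ℚ; 0ℚ; 1ℚ; _+_; _*_; -_; _-_; 1/_; NonZero; ≢-nonZero)
  open import Data.Rational.Properties
    using ( _≟_; 1≢0; +-assoc; +-identityˡ; +-identityʳ; +-inverseʳ; *-assoc; *-zeroˡ; *-zeroʳ
          ; *-identityˡ; *-identityʳ; *-inverseˡ; neg-distribˡ-*; neg-distribʳ-*; +-0-group; +-*-commutativeRing)
  open import Data.Rational.Solver using (module +-*-Solver)
  open import Algebra.Properties.Semiring.Sum (CommutativeRing.semiring +-*-commutativeRing)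
    using (sum; sum-cong-≗; sum-replicate-zero; ∑-distrib-+; ∑-comm; sum-remove; *-distribˡ-sum; *-distribʳ-sum)
  open import Algebra.Properties.Group +-0-group using (inverseˡ-unique)
  open +-*-Solver using (solve; _:=_; _:+_; _:-_; _:*_; :-_; con)
  open ≡-Reasoning

  private
    variable
      k m n r d d₁ d₂ : ℕ

  0ᵛ : Vector ℚ n
  0ᵛ _ = 0ℚ

  infixl 6 _+ᵛ_ _-ᵛ_
  infixl 7 _*ᵛ_

  _+ᵛ_ : Vector ℚ n → Vector ℚ n → Vector ℚ n
  (x +ᵛ y) i = x i + y i

  _-ᵛ_ : Vector ℚ n → Vector ℚ n → Vector ℚ n
  (x -ᵛ y) i = x i - y i

  _*ᵛ_ : ℚ → Vector ℚ n → Vector ℚ n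
  (c *ᵛ x) i = c * x i

  lc : Vector ℚ k → (Fin k → Vector ℚ n) → Vector ℚ n
  lc c vs i = sumℚ (λ l → c l * vs l i)

  a*x+y≡0⇒x≡-[1/a]*y : ∀ a {x y} .{{_ : NonZero a}} → a * x + y ≡ 0ℚ → x ≡ - (1/ a) * y
  a*x+y≡0⇒x≡-[1/a]*y a {x} {y} ax+y≡0 = begin
    x               ≡⟨ sym (*-identityˡ x) ⟩
    1ℚ * x          ≡⟨ cong (_* x) (sym (*-inverseˡ a)) ⟩
    1/ a * a * x    ≡⟨ *-assoc (1/ a) a x ⟩
    1/ a * (a * x)  ≡⟨ cong (1/ a *_) (inverseˡ-unique (a * x) y ax+y≡0) ⟩
    1/ a * - y      ≡⟨ sym (neg-distribʳ-* (1/ a) y) ⟩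
    - (1/ a * y)    ≡⟨ neg-distribˡ-* (1/ a) y ⟩
    - (1/ a) * y    ∎

  sumℚ≡sum : sumℚ {n} ≡ sum {n}
  sumℚ≡sum {zero}  = refl
  sumℚ≡sum {suc n} = cong (λ s f → f zero + s (f ∘ suc)) (sumℚ≡sum {n})

  sumℚ-cong : ∀ {f g : Vector ℚ n} → f ≗ g → sumℚ f ≡ sumℚ g
  sumℚ-cong {n} rewrite sumℚ≡sum {n} = sum-cong-≗

  sumℚ-zero : ∀ {f : Vector ℚ n} → f ≗ 0ᵛ → sumℚ f ≡ 0ℚ
  sumℚ-zero {n} f≗0 rewrite sumℚ≡sum {n} = trans (sum-cong-≗ f≗0) (sum-replicate-zero n)

  sumℚ-distrib-+ : ∀ (f g : Vector ℚ n) → sumℚ (f +ᵛ g) ≡ sumℚ f + sumℚ g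
  sumℚ-distrib-+ {n} rewrite sumℚ≡sum {n} = ∑-distrib-+

  *-distribˡ-sumℚ : ∀ x (f : Vector ℚ n) → x * sumℚ f ≡ sumℚ (x *ᵛ f)
  *-distribˡ-sumℚ {n} rewrite sumℚ≡sum {n} = *-distribˡ-sum

  *-distribʳ-sumℚ : ∀ x (f : Vector ℚ n) → sumℚ f * x ≡ sumℚ (λ i → f i * x)
  *-distribʳ-sumℚ {n} rewrite sumℚ≡sum {n} = *-distribʳ-sum

  sumℚ-comm : ∀ (f : Fin m → Fin n → ℚ) → sumℚ (λ i → sumℚ (f i)) ≡ sumℚ (λ j → sumℚ (λ i → f i j))
  sumℚ-comm {m} {n} rewrite sumℚ≡sum {m} | sumℚ≡sum {n} = ∑-comm

  sumℚ-remove : ∀ (f : Vector ℚ (suc n)) i → sumℚ f ≡ f i + sumℚ (removeAt f i)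
  sumℚ-remove {n} f i rewrite sumℚ≡sum {n} = sum-remove f

  sumℚ-single : ∀ (f : Vector ℚ n) i → (∀ j → j ≢ i → f j ≡ 0ℚ) → sumℚ f ≡ f i
  sumℚ-single {suc n} f i f≡0 = begin
    sumℚ f                     ≡⟨ sumℚ-remove f i ⟩
    f i + sumℚ (removeAt f i)  ≡⟨ cong (f i +_) (sumℚ-zero (λ j → f≡0 (punchIn i j) (punchInᵢ≢i i j))) ⟩
    f i + 0ℚ                   ≡⟨ +-identityʳ (f i) ⟩
    f i                        ∎

  sumℚ-↑ : ∀ (f : Vector ℚ (m ℕ.+ r)) → sumℚ f ≡ sumℚ (f ∘ (_↑ˡ r)) + sumℚ (f ∘ (m ↑ʳ_))
  sumℚ-↑ {zero}  f = sym (+-identityˡ (sumℚ f))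
  sumℚ-↑ {suc m} {r} f = trans (cong (f zero +_) (sumℚ-↑ {m} {r} (f ∘ suc))) (sym (+-assoc (f zero) _ _))

  ∀-↑ : ∀ {P : Fin (m ℕ.+ r) → Set} → (∀ i → P (i ↑ˡ r)) → (∀ j → P (m ↑ʳ j)) → ∀ k → P k
  ∀-↑ {m} {P = P} Pˡ Pʳ k with splitAt m k in eq
  ... | inj₁ i = subst P (splitAt⁻¹-↑ˡ eq) (Pˡ i)
  ... | inj₂ j = subst P (splitAt⁻¹-↑ʳ eq) (Pʳ j)

  lc-*ˡ : ∀ a (c : Vector ℚ k) (vs : Fin k → Vector ℚ n) → lc (a *ᵛ c) vs ≗ a *ᵛ lc c vs
  lc-*ˡ a c vs i =
    trans (sumℚ-cong (λ l → *-assoc a (c l) (vs l i))) (sym (*-distribˡ-sumℚ a (λ l → c l * vs l i)))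

  lc-cong : ∀ {c c′ : Vector ℚ k} (vs : Fin k → Vector ℚ n) → c ≗ c′ → lc c vs ≗ lc c′ vs
  lc-cong vs c≗c′ i = sumℚ-cong (λ l → cong (_* vs l i) (c≗c′ l))

  lc-zeroˡ : ∀ {c : Vector ℚ k} (vs : Fin k → Vector ℚ n) → c ≗ 0ᵛ → lc c vs ≗ 0ᵛ
  lc-zeroˡ vs c≗0 i = sumℚ-zero (λ l → trans (cong (_* vs l i) (c≗0 l)) (*-zeroˡ (vs l i)))

  lc-zeroʳ : ∀ (c : Vector ℚ k) {vs : Fin k → Vector ℚ n} → (∀ l → vs l ≗ 0ᵛ) → lc c vs ≗ 0ᵛ
  lc-zeroʳ c vs≗0 i = sumℚ-zero (λ l → trans (cong (c l *_) (vs≗0 l i)) (*-zeroʳ (c l)))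

  lc-++ : ∀ (c : Vector ℚ (m ℕ.+ r)) (xs : Fin m → Vector ℚ n) (ys : Fin r → Vector ℚ n) →
          lc c (xs ++ ys) ≗ lc (c ∘ (_↑ˡ r)) xs +ᵛ lc (c ∘ (m ↑ʳ_)) ys
  lc-++ {m = m} {r = r} c xs ys i = trans (sumℚ-↑ {m} {r} (λ l → c l * (xs ++ ys) l i)) (cong₂ _+_
    (sumℚ-cong (λ l → cong (λ x → c (l ↑ˡ r) * x i) (lookup-++ˡ xs ys l)))
    (sumℚ-cong (λ l → cong (λ y → c (_ ↑ʳ l) * y i) (lookup-++ʳ xs ys l))))

  lc-lc : ∀ (c : Vector ℚ m) (γ : Fin m → Vector ℚ k) (F : Fin k → Vector ℚ n) →
          lc c (λ l → lc (γ l) F) ≗ lc (lc c γ) F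
  lc-lc c γ F i = begin
    sumℚ (λ l → c l * sumℚ (λ t → γ l t * F t i))
      ≡⟨ sumℚ-cong (λ l → *-distribˡ-sumℚ (c l) (λ t → γ l t * F t i)) ⟩
    sumℚ (λ l → sumℚ (λ t → c l * (γ l t * F t i)))
      ≡⟨ sumℚ-comm (λ l t → c l * (γ l t * F t i)) ⟩
    sumℚ (λ t → sumℚ (λ l → c l * (γ l t * F t i)))
      ≡⟨ sumℚ-cong (λ t → trans (sumℚ-cong (λ l → sym (*-assoc (c l) (γ l t) (F t i))))
                                (sym (*-distribʳ-sumℚ (F t i) (λ l → c l * γ l t)))) ⟩
    sumℚ (λ t → sumℚ (λ l → c l * γ l t) * F t i)
      ∎

  lc-insertAt : ∀ (c : Vector ℚ k) j x (vs : Fin (suc k) → Vector ℚ n) →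
                lc (insertAt c j x) vs ≗ x *ᵛ vs j +ᵛ lc c (removeAt vs j)
  lc-insertAt c j x vs i = trans (sumℚ-remove (λ l → insertAt c j x l * vs l i) j) (cong₂ _+_
    (cong (_* vs j i) (insertAt-lookup c j x))
    (sumℚ-cong (λ l → cong (_* vs (punchIn j l) i) (insertAt-punchIn c j x l))))

  record IsLinear (f : Vector ℚ m → Vector ℚ n) : Set where
    field
      cong-≗ : ∀ {x y} → x ≗ y → f x ≗ f y
      +-homo : ∀ x y → f (x +ᵛ y) ≗ f x +ᵛ f y
      *-homo : ∀ c x → f (c *ᵛ x) ≗ c *ᵛ f x

    0-homo : f 0ᵛ ≗ 0ᵛ
    0-homo i = begin
      f 0ᵛ i          ≡⟨ cong-≗ (λ _ → sym (*-zeroˡ 0ℚ)) i ⟩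
      f (0ℚ *ᵛ 0ᵛ) i  ≡⟨ *-homo 0ℚ 0ᵛ i ⟩
      0ℚ * f 0ᵛ i     ≡⟨ *-zeroˡ (f 0ᵛ i) ⟩
      0ℚ              ∎

    lc-homo : ∀ {k} (c : Vector ℚ k) vs → f (lc c vs) ≗ lc c (f ∘ vs)
    lc-homo {zero}  c vs = 0-homo
    lc-homo {suc k} c vs i = trans (+-homo (c zero *ᵛ vs zero) (lc (c ∘ suc) (vs ∘ suc)) i)
      (cong₂ _+_ (*-homo (c zero) (vs zero) i) (lc-homo (c ∘ suc) (vs ∘ suc) i))

    -homo : ∀ x y → f (x -ᵛ y) ≗ f x -ᵛ f y
    -homo x y i = begin
      f (x -ᵛ y) i                ≡⟨ cong-≗ (λ j → a-b≡a+[-1]b (x j) (y j)) i ⟩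
      f (x +ᵛ (- 1ℚ) *ᵛ y) i      ≡⟨ +-homo x ((- 1ℚ) *ᵛ y) i ⟩
      f x i + f ((- 1ℚ) *ᵛ y) i   ≡⟨ cong (f x i +_) (*-homo (- 1ℚ) y i) ⟩
      f x i + (- 1ℚ) * f y i      ≡⟨ sym (a-b≡a+[-1]b (f x i) (f y i)) ⟩
      f x i - f y i               ∎
      where
        a-b≡a+[-1]b : ∀ a b → a - b ≡ a + (- 1ℚ) * b
        a-b≡a+[-1]b = solve 2 (λ a b → a :- b := a :+ (:- con 1ℚ) :* b) refl

  LinIndep-cong : ∀ {xs ys : Fin k → Vector ℚ n} → (∀ l → xs l ≗ ys l) → LinIndep xs → LinIndep ys
  LinIndep-cong xs≗ys xs-indep c lc≡0 =
    xs-indep c (λ i → trans (sumℚ-cong (λ l → cong (c l *_) (xs≗ys l i))) (lc≡0 i))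

  LinIndep-insertAt : ∀ (vs : Fin (suc k) → Vector ℚ n) → LinIndep vs →
                      ∀ c j x → lc (insertAt c j x) vs ≗ 0ᵛ → c ≗ 0ᵛ
  LinIndep-insertAt vs vs-indep c j x lc≡0 l =
    trans (sym (insertAt-punchIn c j x l)) (vs-indep (insertAt c j x) lc≡0 (punchIn j l))

  LinIndep-removeAt : ∀ (vs : Fin (suc k) → Vector ℚ n) → LinIndep vs → ∀ j → LinIndep (removeAt vs j)
  LinIndep-removeAt vs vs-indep j c lc≡0 = LinIndep-insertAt vs vs-indep c j 0ℚ λ i → begin
    lc (insertAt c j 0ℚ) vs i             ≡⟨ lc-insertAt c j 0ℚ vs i ⟩
    0ℚ * vs j i + lc c (removeAt vs j) i  ≡⟨ cong₂ _+_ (*-zeroˡ (vs j i)) (lc≡0 i) ⟩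
    0ℚ + 0ℚ                               ≡⟨ +-identityˡ 0ℚ ⟩
    0ℚ                                    ∎

  -- A dependency c of the new family lifts to a dependency of vs: insert −Σ cₗ rₗ at j.
  LinIndep-subtract : ∀ (vs : Fin (suc k) → Vector ℚ n) → LinIndep vs →
                      ∀ j (r : Vector ℚ k) → LinIndep (λ l → removeAt vs j l -ᵛ r l *ᵛ vs j)
  LinIndep-subtract {k = k} {n = n} vs vs-indep j r c lc≡0 = LinIndep-insertAt vs vs-indep c j (- s) λ i → begin
    lc (insertAt c j (- s)) vs i                 ≡⟨ lc-insertAt c j (- s) vs i ⟩
    - s * vs j i + lc c (removeAt vs j) i        ≡⟨ cong (- s * vs j i +_) (removed i) ⟩
    - s * vs j i + (lc c ws i + s * vs j i)      ≡⟨ cong (λ t → - s * vs j i + (t + s * vs j i)) (lc≡0 i) ⟩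
    - s * vs j i + (0ℚ + s * vs j i)             ≡⟨ -sb+[0+sb]≡0 s (vs j i) ⟩
    0ℚ                                           ∎
    where
      s : ℚ
      s = sumℚ (λ l → c l * r l)
      ws : Fin k → Vector ℚ n
      ws l = removeAt vs j l -ᵛ r l *ᵛ vs j
      c[a-rb]+crb≡ca : ∀ c a r b → c * (a - r * b) + c * r * b ≡ c * a
      c[a-rb]+crb≡ca = solve 4 (λ c a r b → c :* (a :- r :* b) :+ c :* r :* b := c :* a) refl
      -sb+[0+sb]≡0 : ∀ s b → - s * b + (0ℚ + s * b) ≡ 0ℚ
      -sb+[0+sb]≡0 = solve 2 (λ s b → :- s :* b :+ (con 0ℚ :+ s :* b) := con 0ℚ) refl
      removed : ∀ i → lc c (removeAt vs j) i ≡ lc c ws i + s * vs j i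
      removed i = sym (begin
        lc c ws i + s * vs j i
          ≡⟨ cong (lc c ws i +_) (*-distribʳ-sumℚ (vs j i) (λ l → c l * r l)) ⟩
        lc c ws i + sumℚ (λ l → c l * r l * vs j i)
          ≡⟨ sym (sumℚ-distrib-+ (λ l → c l * ws l i) (λ l → c l * r l * vs j i)) ⟩
        sumℚ (λ l → c l * ws l i + c l * r l * vs j i)
          ≡⟨ sumℚ-cong (λ l → c[a-rb]+crb≡ca (c l) (vs (punchIn j l) i) (r l) (vs j i)) ⟩
        lc c (removeAt vs j) i
          ∎)

  LinIndep-map-tail : ∀ (vs : Fin k → Vector ℚ (suc n)) → (∀ l → vs l zero ≡ 0ℚ) →
                      LinIndep vs → LinIndep (tail ∘ vs)
  LinIndep-map-tail vs vs₀≡0 vs-indep c lc≡0 = vs-indep c λ where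
    zero    → sumℚ-zero (λ l → trans (cong (c l *_) (vs₀≡0 l)) (*-zeroʳ (c l)))
    (suc i) → lc≡0 i

  pivot-elimination : ∀ (vs : Fin (suc k) → Vector ℚ (suc n)) → LinIndep vs →
                      ∃[ j ] (vs j zero ≢ 0ℚ) → ∃[ ws ] (LinIndep {n} {k} ws)
  pivot-elimination {k = k} {n = n} vs vs-indep (j , pivot≢0) =
    tail ∘ ws , LinIndep-map-tail ws ws₀≡0 (LinIndep-subtract vs vs-indep j ρ)
    where
      instance
        pivot-nonZero : NonZero (vs j zero)
        pivot-nonZero = ≢-nonZero pivot≢0
      ρ : Vector ℚ k
      ρ l = vs (punchIn j l) zero * 1/ vs j zero
      ws : Fin k → Vector ℚ (suc n)
      ws l = removeAt vs j l -ᵛ ρ l *ᵛ vs j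
      ws₀≡0 : ∀ l → ws l zero ≡ 0ℚ
      ws₀≡0 l = begin
        a - a * 1/ t * t    ≡⟨ cong (λ x → a - x) (*-assoc a (1/ t) t) ⟩
        a - a * (1/ t * t)  ≡⟨ cong (λ x → a - a * x) (*-inverseˡ t) ⟩
        a - a * 1ℚ          ≡⟨ cong (λ x → a - x) (*-identityʳ a) ⟩
        a - a               ≡⟨ +-inverseʳ a ⟩
        0ℚ                  ∎
        where
          a t : ℚ
          a = vs (punchIn j l) zero
          t = vs j zero

  LinIndep⇒≤ : ∀ (vs : Fin m → Vector ℚ n) → LinIndep vs → m ≤ n
  LinIndep⇒≤ {zero}          vs vs-indep = z≤n
  LinIndep⇒≤ {suc m} {zero}  vs vs-indep = contradiction (vs-indep (λ _ → 1ℚ) (λ ()) zero) 1≢0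
  LinIndep⇒≤ {suc m} {suc n} vs vs-indep with all? (λ l → vs l zero ≟ 0ℚ)
  ... | yes vs₀≡0 = m≤n⇒m≤1+n (LinIndep⇒≤ (tail ∘ vs) (LinIndep-map-tail vs vs₀≡0 vs-indep))
  ... | no vs₀≢0 =
    let ws , ws-indep = pivot-elimination vs vs-indep (¬∀⟶∃¬ _ _ (λ l → vs l zero ≟ 0ℚ) vs₀≢0)
    in s≤s (LinIndep⇒≤ ws ws-indep)

  Maximal : (Vector ℚ n → Set) → ℕ → Set
  Maximal {n} W d = ∀ (ws : Fin (suc d) → Vector ℚ n) → (∀ l → W (ws l)) → ¬ LinIndep ws

  -- Nullity G S d unfolds to HasDim (InKernel G S) d.
  HasDim : (Vector ℚ n → Set) → ℕ → Set
  HasDim {n} W d = (∃[ bs ] ((∀ l → W (bs l)) × LinIndep {n} {d} bs)) × Maximal W d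

  LinIndep⇒≤dim : ∀ {W : Vector ℚ n → Set} → HasDim W d →
                  (vs : Fin m → Vector ℚ n) → (∀ l → W (vs l)) → LinIndep vs → m ≤ d
  LinIndep⇒≤dim {n = n} {d = d} {W = W} (_ , maximal) vs vs∈W vs-indep =
    ≮⇒≥ (λ d<m → too-many d<m vs vs∈W vs-indep)
    where
      too-many : ∀ {m} → d < m → (vs : Fin m → Vector ℚ n) → (∀ l → W (vs l)) → ¬ LinIndep vs
      too-many {suc m} (s≤s d≤m) vs vs∈W vs-indep with m≤n⇒m<n∨m≡n d≤m
      ... | inj₁ d<m  = too-many d<m (removeAt vs zero) (vs∈W ∘ suc) (LinIndep-removeAt vs vs-indep zero)
      ... | inj₂ refl = maximal vs vs∈W vs-indep

  dim-gap⇒nonzero-coordinate : ∀ {W W′ : Vector ℚ n → Set} → HasDim W d → HasDim W′ (suc d) →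
                               ∀ j → (∀ {x} → W′ x → x j ≡ 0ℚ → W x) → ∃[ x ] (W′ x × x j ≢ 0ℚ)
  dim-gap⇒nonzero-coordinate (_ , maximal) ((bs , bs∈W′ , bs-indep) , _) j W′∩[j≡0]⊆W
    with all? (λ l → bs l j ≟ 0ℚ)
  ... | yes bs[j]≡0 = contradiction bs-indep (maximal bs (λ l → W′∩[j≡0]⊆W (bs∈W′ l) (bs[j]≡0 l)))
  ... | no ¬bs[j]≡0 =
    let l , bs[j]≢0 = ¬∀⟶∃¬ _ _ (λ l → bs l j ≟ 0ℚ) ¬bs[j]≡0
    in bs l , bs∈W′ l , bs[j]≢0

  infix 4 _∈span_
  _∈span_ : Vector ℚ n → (Fin k → Vector ℚ n) → Set
  w ∈span vs = ∃[ c ] (w ≗ lc c vs)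

  LinIndep-∷ : ∀ {w} {bs : Fin k → Vector ℚ n} → LinIndep bs → ¬ (w ∈span bs) → LinIndep (w ∷ bs)
  LinIndep-∷ {w = w} {bs} bs-indep w∉span c lc≡0 with c zero ≟ 0ℚ
  ... | yes c₀≡0 = λ where
        zero    → c₀≡0
        (suc l) → bs-indep (c ∘ suc) tail≡0 l
    where
      tail≡0 : ∀ i → lc (c ∘ suc) bs i ≡ 0ℚ
      tail≡0 i = begin
        lc (c ∘ suc) bs i                 ≡⟨ sym (+-identityˡ _) ⟩
        0ℚ + lc (c ∘ suc) bs i            ≡⟨ cong (_+ lc (c ∘ suc) bs i) (sym (*-zeroˡ (w i))) ⟩
        0ℚ * w i + lc (c ∘ suc) bs i      ≡⟨ cong (λ a → a * w i + lc (c ∘ suc) bs i) (sym c₀≡0) ⟩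
        c zero * w i + lc (c ∘ suc) bs i  ≡⟨ lc≡0 i ⟩
        0ℚ                                ∎
  ... | no c₀≢0 = contradiction (- (1/ c zero) *ᵛ (c ∘ suc) , w≗) w∉span
    where
      instance
        c₀-nonZero : NonZero (c zero)
        c₀-nonZero = ≢-nonZero c₀≢0
      w≗ : w ≗ lc (- (1/ c zero) *ᵛ (c ∘ suc)) bs
      w≗ i = trans (a*x+y≡0⇒x≡-[1/a]*y (c zero) (lc≡0 i)) (sym (lc-*ˡ (- (1/ c zero)) (c ∘ suc) bs i))

  maximal⇒spans : ∀ {W : Vector ℚ n → Set} {bs : Fin d → Vector ℚ n} → Maximal W d →
                  (∀ l → W (bs l)) → LinIndep bs → ∀ {w} → W w → ¬ ¬ (w ∈span bs)
  maximal⇒spans {bs = bs} maximal bs∈W bs-indep {w} w∈W w∉span =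
    maximal (w ∷ bs) (λ where zero → w∈W ; (suc l) → bs∈W l) (LinIndep-∷ bs-indep w∉span)

  ¬¬-choice : ∀ {P : Fin k → Set} → (∀ l → ¬ ¬ P l) → ¬ ¬ (∀ l → P l)
  ¬¬-choice {zero}  ¬¬P ¬∀P = ¬∀P (λ ())
  ¬¬-choice {suc k} ¬¬P ¬∀P = ¬¬P zero λ P₀ → ¬¬-choice (¬¬P ∘ suc) λ P₊ → ¬∀P λ where
    zero    → P₀
    (suc l) → P₊ l

  LinIndep-coefficients : ∀ {xs : Fin m → Vector ℚ n} {γ : Fin m → Vector ℚ k} {F : Fin k → Vector ℚ n} →
                          (∀ l → xs l ≗ lc (γ l) F) → LinIndep xs → LinIndep γ
  LinIndep-coefficients {xs = xs} {γ} {F} xs≗ xs-indep c lcγ≡0 = xs-indep c λ i → begin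
    lc c xs i                  ≡⟨ sumℚ-cong (λ l → cong (c l *_) (xs≗ l i)) ⟩
    lc c (λ l → lc (γ l) F) i  ≡⟨ lc-lc c γ F i ⟩
    lc (lc c γ) F i            ≡⟨ lc-zeroˡ F lcγ≡0 i ⟩
    0ℚ                         ∎

  spanned⇒dim≤ : ∀ {W : Vector ℚ n → Set} → HasDim W d → (F : Fin k → Vector ℚ n) →
                 (∀ {w} → W w → ¬ ¬ (w ∈span F)) → d ≤ k
  spanned⇒dim≤ {d = d} {k = k} ((xs , xs∈W , xs-indep) , _) F spans =
    decidable-stable (d ≤? k) λ d≰k →
      ¬¬-choice (λ l → spans (xs∈W l)) λ coords →
        d≰k (LinIndep⇒≤ (proj₁ ∘ coords) (LinIndep-coefficients (proj₂ ∘ coords) xs-indep))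

  LinIndep-++ : ∀ {π : Vector ℚ n → Vector ℚ k} {xs : Fin m → Vector ℚ n} {ys : Fin r → Vector ℚ n} →
                IsLinear π → (∀ i → π (xs i) ≗ 0ᵛ) → LinIndep xs → LinIndep (π ∘ ys) → LinIndep (xs ++ ys)
  LinIndep-++ {m = m} {r = r} {π = π} {xs = xs} {ys = ys} π-linear πxs≗0 xs-indep πys-indep c lc≡0 =
    ∀-↑ cˡ≡0 cʳ≡0
    where
      open IsLinear π-linear
      cˡ : Vector ℚ m
      cˡ = c ∘ (_↑ˡ r)
      cʳ : Vector ℚ r
      cʳ = c ∘ (m ↑ʳ_)
      split : lc c (xs ++ ys) ≗ lc cˡ xs +ᵛ lc cʳ ys
      split = lc-++ c xs ys
      cʳ≡0 : cʳ ≗ 0ᵛ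
      cʳ≡0 = πys-indep cʳ λ i → begin
        lc cʳ (π ∘ ys) i                         ≡⟨ sym (+-identityˡ _) ⟩
        0ℚ + lc cʳ (π ∘ ys) i                    ≡⟨ cong (_+ lc cʳ (π ∘ ys) i) (sym (lc-zeroʳ cˡ πxs≗0 i)) ⟩
        lc cˡ (π ∘ xs) i + lc cʳ (π ∘ ys) i      ≡⟨ sym (cong₂ _+_ (lc-homo cˡ xs i) (lc-homo cʳ ys i)) ⟩
        π (lc cˡ xs) i + π (lc cʳ ys) i          ≡⟨ sym (+-homo (lc cˡ xs) (lc cʳ ys) i) ⟩
        π (lc cˡ xs +ᵛ lc cʳ ys) i               ≡⟨ cong-≗ (λ j → trans (sym (split j)) (lc≡0 j)) i ⟩
        π 0ᵛ i                                   ≡⟨ 0-homo i ⟩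
        0ℚ                                       ∎
      cˡ≡0 : cˡ ≗ 0ᵛ
      cˡ≡0 = xs-indep cˡ λ i → begin
        lc cˡ xs i                  ≡⟨ sym (+-identityʳ _) ⟩
        lc cˡ xs i + 0ℚ             ≡⟨ cong (lc cˡ xs i +_) (sym (lc-zeroˡ ys cʳ≡0 i)) ⟩
        lc cˡ xs i + lc cʳ ys i     ≡⟨ sym (split i) ⟩
        lc c (xs ++ ys) i           ≡⟨ lc≡0 i ⟩
        0ℚ                          ∎

  restrict : Subset n → Vector ℚ n → Vector ℚ n
  restrict S x i = if does (i ∈? S) then x i else 0ℚ

  restrict-∈ : ∀ {S : Subset n} {x i} → i ∈ S → restrict S x i ≡ x i
  restrict-∈ {S = S} {i = i} i∈S rewrite dec-true (i ∈? S) i∈S = refl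

  restrict-∉ : ∀ {S : Subset n} {x i} → i ∉ S → restrict S x i ≡ 0ℚ
  restrict-∉ {S = S} {i = i} i∉S rewrite dec-false (i ∈? S) i∉S = refl

  restrict-linear : ∀ (S : Subset n) → IsLinear (restrict S)
  restrict-linear S .IsLinear.cong-≗ x≗y i with i ∈? S
  ... | yes _ = x≗y i
  ... | no _  = refl
  restrict-linear S .IsLinear.+-homo x y i with i ∈? S
  ... | yes _ = refl
  ... | no _  = sym (+-identityˡ 0ℚ)
  restrict-linear S .IsLinear.*-homo c x i with i ∈? S
  ... | yes _ = refl
  ... | no _  = sym (*-zeroʳ c)

  record DirectSum (W W₁ : Vector ℚ n → Set) (W₂ : Vector ℚ m → Set) : Set where
    field
      ι        : Vector ℚ m → Vector ℚ n
      π        : Vector ℚ n → Vector ℚ m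
      ι-linear : IsLinear ι
      π-linear : IsLinear π
      W₁⊆W     : ∀ {x} → W₁ x → W x
      ιW₂⊆W    : ∀ {y} → W₂ y → W (ι y)
      πW₁≗0    : ∀ {x} → W₁ x → π x ≗ 0ᵛ
      πι≗id    : ∀ {y} → W₂ y → π (ι y) ≗ y
      πW⊆W₂    : ∀ {x} → W x → W₂ (π x)
      x-ιπx∈W₁ : ∀ {x} → W x → W₁ (x -ᵛ ι (π x))

  DirectSum⇒dim≡ : ∀ {W W₁ : Vector ℚ n → Set} {W₂ : Vector ℚ m → Set} → DirectSum W W₁ W₂ →
                   HasDim W₁ d₁ → HasDim W₂ d₂ → HasDim W d → d ≡ d₁ ℕ.+ d₂
  DirectSum⇒dim≡ {n = n} {d₁ = d₁} {d₂ = d₂} {W = W} {W₁} {W₂} ds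
    ((b , b∈W₁ , b-indep) , b-maximal) ((e , e∈W₂ , e-indep) , e-maximal) dim =
    ≤-antisym (spanned⇒dim≤ {W = W} dim F F-spans) (LinIndep⇒≤dim {W = W} dim F F∈W F-indep)
    where
      open DirectSum ds
      module ι = IsLinear ι-linear

      F : Fin (d₁ ℕ.+ d₂) → Vector ℚ n
      F = b ++ (ι ∘ e)

      F∈W : ∀ l → W (F l)
      F∈W = ++⁺ W (W₁⊆W ∘ b∈W₁) (ιW₂⊆W ∘ e∈W₂)

      F-indep : LinIndep F
      F-indep = LinIndep-++ π-linear (πW₁≗0 ∘ b∈W₁) b-indep
                  (LinIndep-cong (λ l i → sym (πι≗id (e∈W₂ l) i)) e-indep)

      F-spans : ∀ {w} → W w → ¬ ¬ (w ∈span F)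
      F-spans {w} w∈W w∉span =
        maximal⇒spans {W = W₁} b-maximal b∈W₁ b-indep (x-ιπx∈W₁ w∈W) λ (α , w-ιπw≗) →
        maximal⇒spans {W = W₂} e-maximal e∈W₂ e-indep (πW⊆W₂ w∈W) λ (β , πw≗) →
        w∉span (α ++ β , λ i → begin
          w i                                        ≡⟨ sym (a-b+b≡a (w i) (ι (π w) i)) ⟩
          (w -ᵛ ι (π w)) i + ι (π w) i               ≡⟨ cong₂ _+_ (w-ιπw≗ i) (ι.cong-≗ πw≗ i) ⟩
          lc α b i + ι (lc β e) i                    ≡⟨ cong (lc α b i +_) (ι.lc-homo β e i) ⟩
          lc α b i + lc β (ι ∘ e) i                  ≡⟨ sym (cong₂ _+_ (lc-cong b (lookup-++ˡ α β) i)
                                                                       (lc-cong (ι ∘ e) (lookup-++ʳ α β) i)) ⟩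
          lc ((α ++ β) ∘ (_↑ˡ d₂)) b i + lc ((α ++ β) ∘ (d₁ ↑ʳ_)) (ι ∘ e) i
                                                     ≡⟨ sym (lc-++ (α ++ β) b (ι ∘ e) i) ⟩
          lc (α ++ β) F i                            ∎)
        where
          a-b+b≡a : ∀ a b → a - b + b ≡ a
          a-b+b≡a = solve 2 (λ a b → a :- b :+ b := a) refl

module Adjacency {n} (G : SignedGraph n) where

  open import Data.Rational using (ℚ; 0ℚ; _+_; _*_; _-_)
  open import Data.Rational.Properties using (+-inverseʳ; *-zeroʳ; *-distribˡ-+; +-*-commutativeRing)
  open import Data.Rational.Solver using (module +-*-Solver)
  open import Algebra.Properties.CommutativeSemigroup
    (CommutativeRing.*-commutativeSemigroup +-*-commutativeRing) using (x∙yz≈y∙xz)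
  open +-*-Solver using (solve; _:=_; _:+_; _:-_; _:*_)
  open LinearAlgebra
  open ≡-Reasoning

  non-adjacent⇒adj≡0 : ∀ {i j} → ¬ Adjacent G i j → adj G i j ≡ 0ℚ
  non-adjacent⇒adj≡0 {i} {j} ¬i~j with edge G i j
  ... | none = refl
  ... | pos  = contradiction (λ ()) ¬i~j
  ... | neg  = contradiction (λ ()) ¬i~j

  mulA : Vector ℚ n → Vector ℚ n
  mulA x i = sumℚ (λ j → adj G i j * x j)

  adj-symmetric : ∀ i j → adj G i j ≡ adj G j i
  adj-symmetric i j = cong sgnℚ (symmetric G i j)

  mulA-linear : IsLinear mulA
  mulA-linear .IsLinear.cong-≗ x≗y i = sumℚ-cong (λ j → cong (adj G i j *_) (x≗y j))
  mulA-linear .IsLinear.+-homo x y i =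
    trans (sumℚ-cong (λ j → *-distribˡ-+ (adj G i j) (x j) (y j)))
          (sumℚ-distrib-+ (λ j → adj G i j * x j) (λ j → adj G i j * y j))
  mulA-linear .IsLinear.*-homo c x i =
    trans (sumℚ-cong (λ j → x∙yz≈y∙xz (adj G i j) c (x j)))
          (sym (*-distribˡ-sumℚ c (λ j → adj G i j * x j)))

  module mulA = IsLinear mulA-linear

  mulA-self-adjoint : ∀ x y → sumℚ (λ i → x i * mulA y i) ≡ sumℚ (λ j → y j * mulA x j)
  mulA-self-adjoint x y = begin
    sumℚ (λ i → x i * mulA y i)
      ≡⟨ sumℚ-cong (λ i → *-distribˡ-sumℚ (x i) (λ j → adj G i j * y j)) ⟩
    sumℚ (λ i → sumℚ (λ j → x i * (adj G i j * y j)))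
      ≡⟨ sumℚ-comm (λ i j → x i * (adj G i j * y j)) ⟩
    sumℚ (λ j → sumℚ (λ i → x i * (adj G i j * y j)))
      ≡⟨ sumℚ-cong (λ j → trans (sumℚ-cong (λ i → trans (cong (λ a → x i * (a * y j)) (adj-symmetric i j))
                                                         (a[bc]≡c[ba] (x i) (adj G j i) (y j))))
                                (sym (*-distribˡ-sumℚ (y j) (λ i → adj G j i * x i)))) ⟩
    sumℚ (λ j → y j * mulA x j)
      ∎
    where
      a[bc]≡c[ba] : ∀ a b c → a * (b * c) ≡ c * (b * a)
      a[bc]≡c[ba] = solve 3 (λ a b c → a :* (b :* c) := c :* (b :* a)) refl

  mulA-agree-off : ∀ {x y : Vector ℚ n} v → (∀ j → j ≢ v → x j ≡ y j) →
                   ∀ i → mulA x i ≡ mulA y i + adj G i v * (x v - y v)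
  mulA-agree-off {x} {y} v x≡y i = begin
    mulA x i                           ≡⟨ sym (b+[a-b]≡a (mulA x i) (mulA y i)) ⟩
    mulA y i + (mulA x i - mulA y i)   ≡⟨ cong (mulA y i +_) (sym (mulA.-homo x y i)) ⟩
    mulA y i + mulA (x -ᵛ y) i         ≡⟨ cong (mulA y i +_) (sumℚ-single _ v term≡0) ⟩
    mulA y i + adj G i v * (x v - y v) ∎
    where
      b+[a-b]≡a : ∀ a b → b + (a - b) ≡ a
      b+[a-b]≡a = solve 2 (λ a b → b :+ (a :- b) := a) refl
      term≡0 : ∀ j → j ≢ v → adj G i j * (x j - y j) ≡ 0ℚ
      term≡0 j j≢v = trans (cong (λ t → adj G i j * (t - y j)) (x≡y j j≢v))
                          (trans (cong (adj G i j *_) (+-inverseʳ (y j))) (*-zeroʳ (adj G i j)))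

  InKernel-*ᵛ : ∀ {S x} c → InKernel G S x → InKernel G S (c *ᵛ x)
  InKernel-*ᵛ c (x-supp , x-rows) =
    (λ i i∉S → trans (cong (c *_) (x-supp i i∉S)) (*-zeroʳ c)) ,
    (λ i i∈S → trans (mulA.*-homo c _ i) (trans (cong (c *_) (x-rows i i∈S)) (*-zeroʳ c)))

module CutVertex {n} (G : SignedGraph n) (v : Fin n) (C : Subset n) (C-component : ComponentOf-v G v C) where

  open import Data.Rational using (ℚ; 0ℚ; 1ℚ; _+_; _*_; -_; _-_; 1/_; NonZero; ≢-nonZero)
  open import Data.Rational.Properties
    using (+-identityʳ; +-inverseʳ; *-zeroˡ; *-zeroʳ; *-identityˡ; *-inverseˡ; +-0-group)
  open import Data.Rational.Solver using (module +-*-Solver)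
  open import Algebra.Properties.Group +-0-group using (inverseˡ-unique)
  open +-*-Solver using (solve; _:=_; _:+_; _:-_; _:*_; :-_; con)
  open LinearAlgebra
  open Adjacency G
  open ≡-Reasoning

  ∈C⇒∈C∪v : ∀ {i} → i ∈ C → i ∈ C ∪ ⁅ v ⁆
  ∈C⇒∈C∪v i∈C = x∈p∪q⁺ (inj₁ i∈C)

  ∉C∪v : ∀ {i} → i ∉ C → i ≢ v → i ∉ C ∪ ⁅ v ⁆
  ∉C∪v i∉C i≢v i∈C∪v = [ i∉C , i≢v ∘ x∈⁅y⁆⇒x≡y v ]′ (x∈p∪q⁻ C ⁅ v ⁆ i∈C∪v)

  ∈C⇒∉∁C : ∀ {i} → i ∈ C → i ∉ ∁ C
  ∈C⇒∉∁C i∈C i∈∁C = x∈∁p⇒x∉p i∈∁C i∈C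

  C⊆minus-v : ∀ {i} → i ∈ C → i ∈ minus v
  C⊆minus-v {i} i∈C with proj₁ (proj₂ C-component i i∈C i) i∈C
  ... | here i∈   = i∈
  ... | step i∈ _ _ = i∈

  v∉C : v ∉ C
  v∉C v∈C = x∈∁p⇒x∉p (C⊆minus-v v∈C) (x∈⁅x⁆ v)

  ≢v⇒∈minus-v : ∀ {i} → i ≢ v → i ∈ minus v
  ≢v⇒∈minus-v i≢v = x∉p⇒x∈∁p (i≢v ∘ x∈⁅y⁆⇒x≡y v)

  adj-leaving-C : ∀ {i j} → i ∈ C → j ∉ C → j ≢ v → adj G i j ≡ 0ℚ
  adj-leaving-C {i} {j} i∈C j∉C j≢v = non-adjacent⇒adj≡0 λ i~j →
    j∉C (proj₂ (proj₂ C-component i i∈C j) (step (C⊆minus-v i∈C) i~j (here (≢v⇒∈minus-v j≢v))))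

  mulA-outside : ∀ {x i} → (∀ j → j ∉ C → x j ≡ 0ℚ) → i ∉ C → i ≢ v → mulA x i ≡ 0ℚ
  mulA-outside {x} {i} x-supp i∉C i≢v = sumℚ-zero term≡0
    where
      term≡0 : ∀ j → adj G i j * x j ≡ 0ℚ
      term≡0 j with j ∈? C
      ... | yes j∈C = trans (cong (_* x j) (trans (adj-symmetric i j) (adj-leaving-C j∈C i∉C i≢v))) (*-zeroˡ (x j))
      ... | no j∉C  = trans (cong (adj G i j *_) (x-supp j j∉C)) (*-zeroʳ (adj G i j))

  mulA-inside : ∀ {x i} → (∀ j → j ∈ C → x j ≡ 0ℚ) → i ∈ C → mulA x i ≡ adj G i v * x v
  mulA-inside {x} {i} x≡0 i∈C = sumℚ-single _ v term≡0
    where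
      term≡0 : ∀ j → j ≢ v → adj G i j * x j ≡ 0ℚ
      term≡0 j j≢v with j ∈? C
      ... | yes j∈C = trans (cong (adj G i j *_) (x≡0 j j∈C)) (*-zeroʳ (adj G i j))
      ... | no j∉C  = trans (cong (_* x j) (adj-leaving-C i∈C j∉C j≢v)) (*-zeroˡ (x j))

  kernel-vector-through-v : ∀ {η} → Nullity G C η → Nullity G (C ∪ ⁅ v ⁆) (suc η) →
                            ∃[ u ] (InKernel G (C ∪ ⁅ v ⁆) u × u v ≡ 1ℚ)
  kernel-vector-through-v dimC dimC+v =
    normalise (dim-gap⇒nonzero-coordinate {W = InKernel G C} dimC dimC+v v vanishing-at-v⇒∈kerC)
    where
      vanishing-at-v⇒∈kerC : ∀ {x} → InKernel G (C ∪ ⁅ v ⁆) x → x v ≡ 0ℚ → InKernel G C x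
      vanishing-at-v⇒∈kerC {x} (x-supp , x-rows) x[v]≡0 = x-supp′ , λ i i∈C → x-rows i (∈C⇒∈C∪v i∈C)
        where
          x-supp′ : ∀ i → i ∉ C → x i ≡ 0ℚ
          x-supp′ i i∉C with i ≟ᶠ v
          ... | yes refl = x[v]≡0
          ... | no i≢v   = x-supp i (∉C∪v i∉C i≢v)
      normalise : ∃[ x ] (InKernel G (C ∪ ⁅ v ⁆) x × x v ≢ 0ℚ) → ∃[ u ] (InKernel G (C ∪ ⁅ v ⁆) u × u v ≡ 1ℚ)
      normalise (x , x∈ker , x[v]≢0) = 1/ x v *ᵛ x , InKernel-*ᵛ (1/ x v) x∈ker , *-inverseˡ (x v)
        where
          instance
            x[v]-nonZero : NonZero (x v)
            x[v]-nonZero = ≢-nonZero x[v]≢0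

  module Splitting (u : Vector ℚ n) (u∈ker : InKernel G (C ∪ ⁅ v ⁆) u) (u[v]≡1 : u v ≡ 1ℚ) where

    u-supp : ∀ i → i ∉ C ∪ ⁅ v ⁆ → u i ≡ 0ℚ
    u-supp = proj₁ u∈ker

    u-rows : ∀ i → i ∈ C ∪ ⁅ v ⁆ → mulA u i ≡ 0ℚ
    u-rows = proj₂ u∈ker

    uC : Vector ℚ n
    uC = restrict C u

    u≡uC-off-v : ∀ j → j ≢ v → u j ≡ uC j
    u≡uC-off-v j j≢v with j ∈? C
    ... | yes _  = refl
    ... | no j∉C = u-supp j (∉C∪v j∉C j≢v)

    mulA-uC-C∪v : ∀ {i} → i ∈ C ∪ ⁅ v ⁆ → mulA uC i ≡ - adj G i v
    mulA-uC-C∪v {i} i∈C∪v = inverseˡ-unique _ _ (begin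
      mulA uC i + adj G i v                  ≡⟨ cong (mulA uC i +_) (sym (a[1-0]≡a (adj G i v))) ⟩
      mulA uC i + adj G i v * (1ℚ - 0ℚ)      ≡⟨ cong₂ (λ a b → mulA uC i + adj G i v * (a - b))
                                                      (sym u[v]≡1) (sym (restrict-∉ {x = u} v∉C)) ⟩
      mulA uC i + adj G i v * (u v - uC v)   ≡⟨ sym (mulA-agree-off v u≡uC-off-v i) ⟩
      mulA u i                               ≡⟨ u-rows i i∈C∪v ⟩
      0ℚ                                     ∎)
      where
        a[1-0]≡a : ∀ a → a * (1ℚ - 0ℚ) ≡ a
        a[1-0]≡a = solve 1 (λ a → a :* (con 1ℚ :- con 0ℚ) := a) refl

    mulA-uC-∉C : ∀ {i} → i ∉ C → mulA uC i ≡ 0ℚ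
    mulA-uC-∉C {i} i∉C with i ≟ᶠ v
    ... | yes refl = trans (mulA-uC-C∪v (x∈p∪q⁺ (inj₂ (x∈⁅x⁆ v)))) (cong (-_) (cong sgnℚ (loopless G v)))
    ... | no i≢v   = mulA-outside (λ j j∉C → restrict-∉ {x = u} j∉C) i∉C i≢v

    kernel-C-at-v : ∀ {z} → InKernel G C z → mulA z v ≡ 0ℚ
    kernel-C-at-v {z} (z-supp , z-rows) = begin
      mulA z v                     ≡⟨ sym (*-identityˡ (mulA z v)) ⟩
      1ℚ * mulA z v                ≡⟨ cong (_* mulA z v) (sym u[v]≡1) ⟩
      u v * mulA z v               ≡⟨ sym (sumℚ-single (λ i → u i * mulA z i) v u*Az≡0) ⟩
      sumℚ (λ i → u i * mulA z i)  ≡⟨ mulA-self-adjoint u z ⟩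
      sumℚ (λ j → z j * mulA u j)  ≡⟨ sumℚ-zero z*Au≡0 ⟩
      0ℚ                           ∎
      where
        u*Az≡0 : ∀ i → i ≢ v → u i * mulA z i ≡ 0ℚ
        u*Az≡0 i i≢v with i ∈? C
        ... | yes i∈C = trans (cong (u i *_) (z-rows i i∈C)) (*-zeroʳ (u i))
        ... | no i∉C  = trans (cong (_* mulA z i) (u-supp i (∉C∪v i∉C i≢v))) (*-zeroˡ (mulA z i))
        z*Au≡0 : ∀ j → z j * mulA u j ≡ 0ℚ
        z*Au≡0 j with j ∈? C
        ... | yes j∈C = trans (cong (z j *_) (u-rows j (∈C⇒∈C∪v j∈C))) (*-zeroʳ (z j))
        ... | no j∉C  = trans (cong (_* mulA u j) (z-supp j j∉C)) (*-zeroˡ (mulA u j))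

    kernel-C⊆kernel-G : ∀ {z} → InKernel G C z → InKernel G ⊤ z
    kernel-C⊆kernel-G {z} z∈ker@(z-supp , z-rows) = (λ i i∉⊤ → contradiction ∈⊤ i∉⊤) , rows
      where
        rows : ∀ i → i ∈ ⊤ → mulA z i ≡ 0ℚ
        rows i _ with i ∈? C | i ≟ᶠ v
        ... | yes i∈C | _        = z-rows i i∈C
        ... | no _    | yes refl = kernel-C-at-v z∈ker
        ... | no i∉C  | no i≢v   = mulA-outside z-supp i∉C i≢v

    extend : Vector ℚ n → Vector ℚ n
    extend p = p +ᵛ p v *ᵛ uC

    extend-linear : IsLinear extend
    extend-linear .IsLinear.cong-≗ x≗y i = cong₂ (λ a b → a + b * uC i) (x≗y i) (x≗y v)
    extend-linear .IsLinear.+-homo x y i = +-homo′ (x i) (y i) (x v) (y v) (uC i)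
      where
        +-homo′ : ∀ a b a′ b′ w → a + b + (a′ + b′) * w ≡ a + a′ * w + (b + b′ * w)
        +-homo′ = solve 5 (λ a b a′ b′ w → a :+ b :+ (a′ :+ b′) :* w := a :+ a′ :* w :+ (b :+ b′ :* w)) refl
    extend-linear .IsLinear.*-homo c x i = *-homo′ c (x i) (x v) (uC i)
      where
        *-homo′ : ∀ c a a′ w → c * a + c * a′ * w ≡ c * (a + a′ * w)
        *-homo′ = solve 4 (λ c a a′ w → c :* a :+ c :* a′ :* w := c :* (a :+ a′ :* w)) refl

    mulA-extend : ∀ p i → mulA (extend p) i ≡ mulA p i + p v * mulA uC i
    mulA-extend p i = trans (mulA.+-homo p (p v *ᵛ uC) i) (cong (mulA p i +_) (mulA.*-homo (p v) uC i))

    mulA-extend-∈C : ∀ {p i} → (∀ j → j ∈ C → p j ≡ 0ℚ) → i ∈ C → mulA (extend p) i ≡ 0ℚ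
    mulA-extend-∈C {p} {i} p≡0 i∈C = begin
      mulA (extend p) i                       ≡⟨ mulA-extend p i ⟩
      mulA p i + p v * mulA uC i              ≡⟨ cong₂ (λ a b → a + p v * b) (mulA-inside p≡0 i∈C)
                                                       (mulA-uC-C∪v (∈C⇒∈C∪v i∈C)) ⟩
      adj G i v * p v + p v * - adj G i v     ≡⟨ ap+p[-a]≡0 (adj G i v) (p v) ⟩
      0ℚ                                      ∎
      where
        ap+p[-a]≡0 : ∀ a p → a * p + p * - a ≡ 0ℚ
        ap+p[-a]≡0 = solve 2 (λ a p → a :* p :+ p :* (:- a) := con 0ℚ) refl

    mulA-extend-∉C : ∀ {p i} → i ∉ C → mulA (extend p) i ≡ mulA p i
    mulA-extend-∉C {p} {i} i∉C = begin
      mulA (extend p) i           ≡⟨ mulA-extend p i ⟩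
      mulA p i + p v * mulA uC i  ≡⟨ cong (λ a → mulA p i + p v * a) (mulA-uC-∉C i∉C) ⟩
      mulA p i + p v * 0ℚ         ≡⟨ cong (mulA p i +_) (*-zeroʳ (p v)) ⟩
      mulA p i + 0ℚ               ≡⟨ +-identityʳ (mulA p i) ⟩
      mulA p i                    ∎

    extend-kernel : ∀ {p} → InKernel G (∁ C) p → InKernel G ⊤ (extend p)
    extend-kernel {p} (p-supp , p-rows) = (λ i i∉⊤ → contradiction ∈⊤ i∉⊤) , rows
      where
        rows : ∀ i → i ∈ ⊤ → mulA (extend p) i ≡ 0ℚ
        rows i _ with i ∈? C
        ... | yes i∈C = mulA-extend-∈C (λ j j∈C → p-supp j (∈C⇒∉∁C j∈C)) i∈C
        ... | no i∉C  = trans (mulA-extend-∉C i∉C) (p-rows i (x∉p⇒x∈∁p i∉C))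

    restrict-kernel-C : ∀ {z} → InKernel G C z → restrict (∁ C) z ≗ 0ᵛ
    restrict-kernel-C (z-supp , _) i with i ∈? ∁ C
    ... | yes i∈∁C = z-supp i (x∈∁p⇒x∉p i∈∁C)
    ... | no _     = refl

    restrict-extend : ∀ {p} → InKernel G (∁ C) p → restrict (∁ C) (extend p) ≗ p
    restrict-extend {p} (p-supp , _) i with i ∈? ∁ C
    ... | yes i∈∁C = begin
      p i + p v * uC i  ≡⟨ cong (λ a → p i + p v * a) (restrict-∉ {x = u} (x∈∁p⇒x∉p i∈∁C)) ⟩
      p i + p v * 0ℚ    ≡⟨ cong (p i +_) (*-zeroʳ (p v)) ⟩
      p i + 0ℚ          ≡⟨ +-identityʳ (p i) ⟩
      p i               ∎
    ... | no i∉∁C  = sym (p-supp i i∉∁C)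

    residual-kernel : ∀ {x} → InKernel G ⊤ x → InKernel G C (x -ᵛ extend (restrict (∁ C) x))
    residual-kernel {x} (_ , x-rows) = supp , rows
      where
        supp : ∀ i → i ∉ C → x i - extend (restrict (∁ C) x) i ≡ 0ℚ
        supp i i∉C = begin
          x i - (restrict (∁ C) x i + restrict (∁ C) x v * uC i)
            ≡⟨ cong₂ (λ a b → x i - (a + restrict (∁ C) x v * b))
                     (restrict-∈ {x = x} (x∉p⇒x∈∁p i∉C)) (restrict-∉ {x = u} i∉C) ⟩
          x i - (x i + restrict (∁ C) x v * 0ℚ)
            ≡⟨ a-[a+b0]≡0 (x i) (restrict (∁ C) x v) ⟩
          0ℚ ∎
          where
            a-[a+b0]≡0 : ∀ a b → a - (a + b * 0ℚ) ≡ 0ℚ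
            a-[a+b0]≡0 = solve 2 (λ a b → a :- (a :+ b :* con 0ℚ) := con 0ℚ) refl
        rows : ∀ i → i ∈ C → mulA (x -ᵛ extend (restrict (∁ C) x)) i ≡ 0ℚ
        rows i i∈C = begin
          mulA (x -ᵛ extend (restrict (∁ C) x)) i               ≡⟨ mulA.-homo x _ i ⟩
          mulA x i - mulA (extend (restrict (∁ C) x)) i         ≡⟨ cong₂ _-_ (x-rows i ∈⊤)
                                                                    (mulA-extend-∈C (λ j j∈C → restrict-∉ {x = x} (∈C⇒∉∁C j∈C)) i∈C) ⟩
          0ℚ - 0ℚ                                               ≡⟨ +-inverseʳ 0ℚ ⟩
          0ℚ                                                    ∎

    restrict-kernel : ∀ {x} → InKernel G ⊤ x → InKernel G (∁ C) (restrict (∁ C) x)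
    restrict-kernel {x} x∈ker@(_ , x-rows) = (λ i i∉∁C → restrict-∉ {x = x} i∉∁C) , rows
      where
        z : Vector ℚ n
        z = x -ᵛ extend (restrict (∁ C) x)
        z-rows : ∀ i → i ∈ ⊤ → mulA z i ≡ 0ℚ
        z-rows = proj₂ (kernel-C⊆kernel-G (residual-kernel x∈ker))
        rows : ∀ i → i ∈ ∁ C → mulA (restrict (∁ C) x) i ≡ 0ℚ
        rows i i∈∁C = begin
          mulA (restrict (∁ C) x) i           ≡⟨ sym (mulA-extend-∉C (x∈∁p⇒x∉p i∈∁C)) ⟩
          mulA (extend (restrict (∁ C) x)) i  ≡⟨ mulA.cong-≗ (λ j → sym (a-[a-b]≡b (x j) _)) i ⟩
          mulA (x -ᵛ z) i                     ≡⟨ mulA.-homo x z i ⟩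
          mulA x i - mulA z i                 ≡⟨ cong₂ _-_ (x-rows i ∈⊤) (z-rows i ∈⊤) ⟩
          0ℚ - 0ℚ                             ≡⟨ +-inverseʳ 0ℚ ⟩
          0ℚ                                  ∎
          where
            a-[a-b]≡b : ∀ a b → a - (a - b) ≡ b
            a-[a-b]≡b = solve 2 (λ a b → a :- (a :- b) := b) refl

    kernel-splitting : DirectSum (InKernel G ⊤) (InKernel G C) (InKernel G (∁ C))
    kernel-splitting = record
      { ι        = extend
      ; π        = restrict (∁ C)
      ; ι-linear = extend-linear
      ; π-linear = restrict-linear (∁ C)
      ; W₁⊆W     = kernel-C⊆kernel-G
      ; ιW₂⊆W    = extend-kernel
      ; πW₁≗0    = restrict-kernel-C
      ; πι≗id    = restrict-extend
      ; πW⊆W₂    = restrict-kernel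
      ; x-ιπx∈W₁ = residual-kernel
      }

open LinearAlgebra using (DirectSum⇒dim≡)
-- Opened only now: inside the modules above, _+_ is addition on ℚ.
open import Data.Nat using (_+_)

theorem3p2 : ∀ {n} (G : SignedGraph n) (v : Fin n) (G₁ : Subset n)
    → Connected G → CutPoint G v → ComponentOf-v G v G₁
    → ∀ (η₁ η₁v ηG ηrest : ℕ)
    → Nullity G G₁ η₁ → Nullity G (G₁ ∪ ⁅ v ⁆) η₁v
    → Nullity G ⊤ ηG → Nullity G (∁ G₁) ηrest
    → η₁v ≡ suc η₁
    → ηG ≡ η₁ + ηrest
theorem3p2 G v G₁ _ _ G₁-component η₁ .(suc η₁) ηG ηrest dimG₁ dimG₁+v dimG dimG-G₁ refl =
  let u , u∈ker , u[v]≡1 = kernel-vector-through-v dimG₁ dimG₁+v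
  in DirectSum⇒dim≡ (Splitting.kernel-splitting u u∈ker u[v]≡1) dimG₁ dimG-G₁ dimG
  where
    open CutVertex G v G₁ G₁-component
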